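{- Let $\mathbf A$ be an iMTL-algebra. The De Morgan laws for $\mathord{\sim}$ are valid in $\mathcal{L}(\mathbf A)$, i.e. for all formulas $\varphi_1,\varphi_2$, in every $\mathbf A$-paraconsistent Kripke model and every state $w$: $(w\models \mathord{\sim}(\varphi_1\wedge\varphi_2))=(w\models \mathord{\sim}\varphi_1\vee\mathord{\sim}\varphi_2)$ and $(w\models \mathord{\sim}(\varphi_1\vee\varphi_2))=(w\models \mathord{\sim}\varphi_1\wedge\mathord{\sim}\varphi_2)$.
   Context: An iMTL-algebra $\mathbf A=\langle A,\sqcap,\sqcup,1,0,\rightharpoonup\rangle$ is a complete lattice with top $1$ and bottom $0$ (monoid operation equal to $\sqcap$) with residuum $\rightharpoonup$ satisfying $a\sqcap b\le c$ iff $b\le a\rightharpoonup c$, and prelinearity $(a\rightharpoonup b)\sqcup(b\rightharpoonup a)=1$; it is enriched with a metric $d$ on $A$. Write $\inf$/$\sup$ for arbitrary meets/joins in $A$. For a pair $x=(a,b)\in A\times A$, $x^+=a$, $x^-=b$. An $\mathbf A$-paraconsistent Kripke model $M=(W,R,V)$ has a finite nonempty set of states $W$, a relation $R\subseteq W\times W\times A\times A$ with at most one tuple per pair of states, $R^+(w,w')=a$ and $R^-(w,w')=b$ if $(w,w',a,b)\in R$ (both $0$ otherwise), $R[w]$ the set of successors of $w$, and a valuation $V:\mathrm{Prop}\times W\to A\times A$. Formulas of the logic $\mathcal{L}(\mathbf A)$ are built from $p\in\mathrm{Prop}$, $\bot$, $\neg$, $\wedge$, $\vee$, $\to$, $\Box$,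 $\Diamond$, two negative modalities and a consistency connective $\circ$. The satisfaction $(w\models\varphi)\in A\times A$ is defined by: $(w\models p)=V(p,w)$; $(w\models\bot)=(0,1)$; if $(w\models\varphi_1)=(a,b)$ and $(w\models\varphi_2)=(c,d)$ then $(w\models\neg\varphi_1)=(b,a)$, $(w\models\varphi_1\wedge\varphi_2)=(a\sqcap c,b\sqcup d)$, $(w\models\varphi_1\vee\varphi_2)=(a\sqcup c,b\sqcap d)$, $(w\models\varphi_1\to\varphi_2)=(a\rightharpoonup c,a\sqcap d)$ (modal and $\circ$ clauses are not needed here). The derived negation is $\mathord{\sim}\varphi:=\varphi\to\bot$, so if $(w\models\varphi)=(a,b)$ then $(w\models\mathord{\sim}\varphi)=(a\rightharpoonup 0,a)$. -}

module Defs where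

open import Data.Nat using (ℕ; suc)
open import Data.Fin using (Fin)
open import Data.Maybe using (Maybe; just; nothing)
open import Data.Product using (_×_; _,_; proj₁; proj₂; Σ)
open import Relation.Binary.PropositionalEquality using (_≡_)
open import Relation.Binary.Structures using (IsPartialOrder)

-- iMTL-algebra: complete lattice (top 1, bottom 0) whose monoid operation
-- is the meet, with residuum ⇀ and prelinearity.
record IMTLAlgebra : Set₁ where
  field
    Carrier : Set
    _≤_     : Carrier → Carrier → Set
    isPartialOrder : IsPartialOrder _≡_ _≤_
    _⊓_ _⊔_ : Carrier → Carrier → Carrier
    𝟙 𝟘     : Carrier
    _⇀_     : Carrier → Carrier → Carrier
    ⊓-lb₁ : ∀ a b → (a ⊓ b) ≤ a
    ⊓-lb₂ : ∀ a b → (a ⊓ b) ≤ b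
    ⊓-glb : ∀ a b c → c ≤ a → c ≤ b → c ≤ (a ⊓ b)
    ⊔-ub₁ : ∀ a b → a ≤ (a ⊔ b)
    ⊔-ub₂ : ∀ a b → b ≤ (a ⊔ b)
    ⊔-lub : ∀ a b c → a ≤ c → b ≤ c → (a ⊔ b) ≤ c
    𝟙-top : ∀ a → a ≤ 𝟙
    𝟘-bot : ∀ a → 𝟘 ≤ a
    inf : (Carrier → Set) → Carrier
    sup : (Carrier → Set) → Carrier
    inf-lb  : ∀ (S : Carrier → Set) a → S a → inf S ≤ a
    inf-glb : ∀ (S : Carrier → Set) c → (∀ a → S a → c ≤ a) → c ≤ inf S
    sup-ub  : ∀ (S : Carrier → Set) a → S a → a ≤ sup S
    sup-lub : ∀ (S : Carrier → Set) c → (∀ a → S a → a ≤ c) → sup S ≤ c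
    residuation₁ : ∀ a b c → (a ⊓ b) ≤ c → b ≤ (a ⇀ c)
    residuation₂ : ∀ a b c → b ≤ (a ⇀ c) → (a ⊓ b) ≤ c
    prelinearity : ∀ a b → ((a ⇀ b) ⊔ (b ⇀ a)) ≡ 𝟙

Prop : Set
Prop = ℕ

data Formula : Set where
  var   : Prop → Formula
  ⊥′    : Formula
  ¬′_   : Formula → Formula
  _∧′_  : Formula → Formula → Formula
  _∨′_  : Formula → Formula → Formula
  _→′_  : Formula → Formula → Formula
  □_    : Formula → Formula
  ◇_    : Formula → Formula
  ■_    : Formula → Formula
  ◆_    : Formula → Formula
  ∘_    : Formula → Formula

∼_ : Formula → Formula
∼ φ = φ →′ ⊥′

module _ (𝐀 : IMTLAlgebra) where
  open IMTLAlgebra 𝐀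

  -- R w w' = just (a , b)  means (w,w',a,b) ∈ R; nothing means no tuple
  -- (this encodes "at most one tuple per pair of states").
  record Model : Set where
    field
      n : ℕ
      R : Fin (suc n) → Fin (suc n) → Maybe (Carrier × Carrier)
      V : Prop → Fin (suc n) → Carrier × Carrier

  module _ (M : Model) where
    open Model M

    W : Set
    W = Fin (suc n)

    R⁺ R⁻ : W → W → Carrier
    R⁺ w w' with R w w'
    ... | just (a , b) = a
    ... | nothing      = 𝟘
    R⁻ w w' with R w w'
    ... | just (a , b) = b
    ... | nothing      = 𝟘

  -- The clauses for □, ◇, the two negative modalities and ∘ are not needed
  -- for the theorem; we leave them as arbitrary (compositional) operations
  -- depending on the model, the truth-value function of the immediate
  -- subformula on all states, and the current state.
  ModalOp : Set
  ModalOp = (M : Model) → (W M → Carrier × Carrier) → W M → Carrier × Carrier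

  record ModalClauses : Set where
    field
      box dia nbox ndia cons : ModalOp

  module _ (C : ModalClauses) (M : Model) where
    open ModalClauses C
    open Model M

    sat : Formula → W M → Carrier × Carrier
    sat (var p) w = V p w
    sat ⊥′ w = 𝟘 , 𝟙
    sat (¬′ φ) w = proj₂ (sat φ w) , proj₁ (sat φ w)
    sat (φ ∧′ ψ) w = (proj₁ (sat φ w) ⊓ proj₁ (sat ψ w)) , (proj₂ (sat φ w) ⊔ proj₂ (sat ψ w))
    sat (φ ∨′ ψ) w = (proj₁ (sat φ w) ⊔ proj₁ (sat ψ w)) , (proj₂ (sat φ w) ⊓ proj₂ (sat ψ w))
    sat (φ →′ ψ) w = (proj₁ (sat φ w) ⇀ proj₁ (sat ψ w)) , (proj₁ (sat φ w) ⊓ proj₂ (sat ψ w))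
    sat (□ φ) w = box M (sat φ) w
    sat (◇ φ) w = dia M (sat φ) w
    sat (■ φ) w = nbox M (sat φ) w
    sat (◆ φ) w = ndia M (sat φ) w
    sat (∘ φ) w = cons M (sat φ) w

{-# OPTIONS --safe #-}
-- The second components agree because 𝟙 is a unit for ⊓. The first ones are
-- the residuation laws (a ⊔ c) ⇀ z = (a ⇀ z) ⊓ (c ⇀ z), valid in every
-- residuated lattice, and (a ⊓ c) ⇀ z = (a ⇀ z) ⊔ (c ⇀ z), which needs
-- prelinearity: as (a ⇀ c) ⊔ (c ⇀ a) = 𝟙, one may assume a ⊓ (a ⇀ c) ≤ c
-- (or symmetrically), and then (a ⊓ c) ⇀ z lies below a ⇀ z.
module Submission where

open import Defs
open import Data.Product using (_×_; _,_; proj₁)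
open import Relation.Binary.PropositionalEquality using (_≡_; refl; sym; cong; cong₂)
open import Relation.Binary.Bundles using (Poset)

module IMTLProperties (𝐀 : IMTLAlgebra) where
  open IMTLAlgebra 𝐀

  poset : Poset _ _ _
  poset = record { isPartialOrder = isPartialOrder }

  open Poset poset using (antisym) renaming (refl to ≤-refl; trans to ≤-trans)
  open import Relation.Binary.Reasoning.PartialOrder poset

  ⊓-comm : ∀ a b → (a ⊓ b) ≡ (b ⊓ a)
  ⊓-comm a b = antisym (swap a b) (swap b a)
    where
    swap : ∀ a b → (a ⊓ b) ≤ (b ⊓ a)
    swap a b = ⊓-glb b a (a ⊓ b) (⊓-lb₂ a b) (⊓-lb₁ a b)

  ⊓-identityʳ : ∀ a → (a ⊓ 𝟙) ≡ a
  ⊓-identityʳ a = antisym (⊓-lb₁ a 𝟙) (⊓-glb a 𝟙 a ≤-refl (𝟙-top a))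

  ⊓-monoʳ-≤ : ∀ a {b c} → b ≤ c → (a ⊓ b) ≤ (a ⊓ c)
  ⊓-monoʳ-≤ a {b} b≤c = ⊓-glb a _ _ (⊓-lb₁ a b) (≤-trans (⊓-lb₂ a b) b≤c)

  modus-ponens : ∀ a b → (a ⊓ (a ⇀ b)) ≤ b
  modus-ponens a b = residuation₂ a (a ⇀ b) b ≤-refl

  ⇀-antitoneˡ : ∀ {a b} z → a ≤ b → (b ⇀ z) ≤ (a ⇀ z)
  ⇀-antitoneˡ {a} {b} z a≤b = residuation₁ a (b ⇀ z) z (begin
    a ⊓ (b ⇀ z)  ≤⟨ ⊓-glb b (b ⇀ z) _ (≤-trans (⊓-lb₁ a _) a≤b) (⊓-lb₂ a _) ⟩
    b ⊓ (b ⇀ z)  ≤⟨ modus-ponens b z ⟩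
    z            ∎)

  ≤-by-prelinearity : ∀ a c {x t} →
    (x ⊓ (a ⇀ c)) ≤ t → (x ⊓ (c ⇀ a)) ≤ t → x ≤ t
  ≤-by-prelinearity a c {x} {t} ac≤t ca≤t = begin
    x                              ≡⟨ sym (⊓-identityʳ x) ⟩
    x ⊓ 𝟙                          ≡⟨ cong (x ⊓_) (sym (prelinearity a c)) ⟩
    x ⊓ ((a ⇀ c) ⊔ (c ⇀ a))        ≤⟨ residuation₂ x _ t
                                         (⊔-lub _ _ _ (residuation₁ x _ t ac≤t)
                                                      (residuation₁ x _ t ca≤t)) ⟩
    t                              ∎

  ⊓-⇀-≤-⇀ : ∀ a c z → (((a ⊓ c) ⇀ z) ⊓ (a ⇀ c)) ≤ (a ⇀ z)
  ⊓-⇀-≤-⇀ a c z = residuation₁ a _ z (begin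
    a ⊓ (x ⊓ (a ⇀ c))        ≤⟨ ⊓-glb _ x _ (⊓-monoʳ-≤ a (⊓-lb₂ x _))
                                          (≤-trans (⊓-lb₂ a _) (⊓-lb₁ x _)) ⟩
    (a ⊓ (a ⇀ c)) ⊓ x        ≤⟨ ⊓-glb (a ⊓ c) x _
                                   (⊓-glb a c _ (≤-trans (⊓-lb₁ _ x) (⊓-lb₁ a _))
                                                (≤-trans (⊓-lb₁ _ x) (modus-ponens a c)))
                                   (⊓-lb₂ _ x) ⟩
    (a ⊓ c) ⊓ x              ≤⟨ modus-ponens (a ⊓ c) z ⟩
    z                        ∎)
    where
    x = (a ⊓ c) ⇀ z

  ⊓-⇀-distrib : ∀ a c z → ((a ⊓ c) ⇀ z) ≡ ((a ⇀ z) ⊔ (c ⇀ z))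
  ⊓-⇀-distrib a c z = antisym
    (≤-by-prelinearity a c
      (≤-trans (⊓-⇀-≤-⇀ a c z) (⊔-ub₁ _ _))
      (begin
        ((a ⊓ c) ⇀ z) ⊓ (c ⇀ a)  ≡⟨ cong (λ u → (u ⇀ z) ⊓ (c ⇀ a)) (⊓-comm a c) ⟩
        ((c ⊓ a) ⇀ z) ⊓ (c ⇀ a)  ≤⟨ ⊓-⇀-≤-⇀ c a z ⟩
        c ⇀ z                    ≤⟨ ⊔-ub₂ _ _ ⟩
        (a ⇀ z) ⊔ (c ⇀ z)        ∎))
    (⊔-lub _ _ _ (⇀-antitoneˡ z (⊓-lb₁ a c)) (⇀-antitoneˡ z (⊓-lb₂ a c)))

  ⊔-⇀-distrib : ∀ a c z → ((a ⊔ c) ⇀ z) ≡ ((a ⇀ z) ⊓ (c ⇀ z))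
  ⊔-⇀-distrib a c z = antisym
    (⊓-glb _ _ _ (⇀-antitoneˡ z (⊔-ub₁ a c)) (⇀-antitoneˡ z (⊔-ub₂ a c)))
    (residuation₁ (a ⊔ c) y z (begin
      (a ⊔ c) ⊓ y  ≡⟨ ⊓-comm (a ⊔ c) y ⟩
      y ⊓ (a ⊔ c)  ≤⟨ residuation₂ y (a ⊔ c) z (⊔-lub a c _ (below a (⊓-lb₁ _ _))
                                                            (below c (⊓-lb₂ _ _))) ⟩
      z            ∎))
    where
    y = (a ⇀ z) ⊓ (c ⇀ z)
    below : ∀ b → y ≤ (b ⇀ z) → b ≤ (y ⇀ z)
    below b y≤b⇀z = residuation₁ y b z (begin
      y ⊓ b        ≡⟨ ⊓-comm y b ⟩
      b ⊓ y        ≤⟨ ⊓-monoʳ-≤ b y≤b⇀z ⟩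
      b ⊓ (b ⇀ z)  ≤⟨ modus-ponens b z ⟩
      z            ∎)

mainTheorem1 : (𝐀 : IMTLAlgebra) (C : ModalClauses 𝐀) (M : Model 𝐀)
    (φ₁ φ₂ : Formula) (w : W 𝐀 M) →
    (sat 𝐀 C M (∼ (φ₁ ∧′ φ₂)) w ≡ sat 𝐀 C M ((∼ φ₁) ∨′ (∼ φ₂)) w)
    × (sat 𝐀 C M (∼ (φ₁ ∨′ φ₂)) w ≡ sat 𝐀 C M ((∼ φ₁) ∧′ (∼ φ₂)) w)
mainTheorem1 𝐀 C M φ₁ φ₂ w =
    cong₂ _,_ (⊓-⇀-distrib a c 𝟘) (unit-both _⊓_)
  , cong₂ _,_ (⊔-⇀-distrib a c 𝟘) (unit-both _⊔_)
  where
  open IMTLAlgebra 𝐀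
  open IMTLProperties 𝐀
  a = proj₁ (sat 𝐀 C M φ₁ w)
  c = proj₁ (sat 𝐀 C M φ₂ w)
  unit-both : ∀ (_∙_ : Carrier → Carrier → Carrier) →
    ((a ∙ c) ⊓ 𝟙) ≡ ((a ⊓ 𝟙) ∙ (c ⊓ 𝟙))
  unit-both _∙_ rewrite ⊓-identityʳ (a ∙ c) | ⊓-identityʳ a | ⊓-identityʳ c = refl
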